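{- Let $G$ be a finite simple undirected graph with set of relevant cycles $\mathcal{C}_{\mathcal{R}}$. The polyhedron-interchangeability relation $\sim_{\mathtt{pi}}$ is an equivalence relation on $\mathcal{C}_{\mathcal{R}}$ (it is reflexive, symmetric and transitive).
   Context: Let $G=(V,E)$ be a finite simple undirected graph. A cycle is a set $C\subseteq E$ such that every vertex of $G$ has even degree in the subgraph with edge set $C$; $|C|$ denotes the number of edges of $C$. The cycles form a vector space (the cycle space) over $GF(2)$ with addition the symmetric difference $C_1\oplus C_2$. A cycle basis is a basis of this vector space. A minimum cycle basis (MCB) is a cycle basis $\mathcal{M}$ minimizing $\sum_{B\in\mathcal{M}}|B|$. The set of relevant cycles $\mathcal{C}_{\mathcal{R}}$ is the union of all MCBs. For $C_1,C_2\in\mathcal{C}_{\mathcal{R}}$, we write $C_1\sim_{\mathtt{pi}}C_2$ ($C_1$ is polyhedron-interchangeable for $C_2$) if there exists an MCB $\mathcal{M}_2$ with $C_2\in\mathcal{M}_2$ such that $(\mathcal{M}_2\setminus\{C_2\})\cup\{C_1\}$ is also an MCB. -}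

module Defs where

open import Data.Nat using (ℕ; zero; suc; _+_; _≤_)
open import Data.Nat.Divisibility using (_∣_)
open import Data.Bool using (Bool; true; false; _∧_; _∨_; _xor_; if_then_else_)
open import Data.Fin using (Fin; zero; suc; _≟_)
open import Data.Fin.Subset using (Subset; ⊥; ∣_∣)
open import Data.Vec using (Vec; []; _∷_; zipWith; lookup; replicate)
open import Data.Nat.ListAction using (sum)
open import Data.List using (List; []; _∷_; length; map; allFin; _[_]∷=_)
open import Data.List.Membership.Propositional using (_∈_)
open import Data.List.Relation.Unary.All using (All)
open import Data.Product using (Σ; _×_; _,_; proj₁; proj₂; ∃)
open import Data.Sum using (_⊎_)
open import Relation.Binary.PropositionalEquality using (_≡_; _≢_)
open import Relation.Nullary.Decidable using (⌊_⌋)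

record Graph : Set where
  field
    nV : ℕ
    nE : ℕ
    ends : Fin nE → Fin nV × Fin nV
    loopless : ∀ e → proj₁ (ends e) ≢ proj₂ (ends e)
    simple : ∀ e f →
      ((proj₁ (ends e) ≡ proj₁ (ends f) × proj₂ (ends e) ≡ proj₂ (ends f))
       ⊎ (proj₁ (ends e) ≡ proj₂ (ends f) × proj₂ (ends e) ≡ proj₁ (ends f)))
      → e ≡ f

open Graph public

EdgeSet : Graph → Set
EdgeSet G = Subset (nE G)

_⊕_ : ∀ {m} → Subset m → Subset m → Subset m
_⊕_ = zipWith _xor_

module _ (G : Graph) where

  incident : Fin (nV G) → Fin (nE G) → Bool
  incident v e = ⌊ v ≟ proj₁ (ends G e) ⌋ ∨ ⌊ v ≟ proj₂ (ends G e) ⌋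

  degreeIn : EdgeSet G → Fin (nV G) → ℕ
  degreeIn C v =
    sum (map (λ e → if lookup C e ∧ incident v e then 1 else 0) (allFin (nE G)))

  IsCycle : EdgeSet G → Set
  IsCycle C = ∀ v → 2 ∣ degreeIn C v

  combo : (M : List (EdgeSet G)) → Vec Bool (length M) → EdgeSet G
  combo [] [] = ⊥
  combo (B ∷ M) (c ∷ cs) = (if c then B else ⊥) ⊕ combo M cs

  LinIndep : List (EdgeSet G) → Set
  LinIndep M = ∀ cs → combo M cs ≡ ⊥ → cs ≡ replicate _ false

  SpansCycles : List (EdgeSet G) → Set
  SpansCycles M = ∀ C → IsCycle C → ∃ λ cs → combo M cs ≡ C

  -- A cycle basis (a finite family of cycles that is a basis of the cycle
  -- space; linear independence forces the members to be distinct, so the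
  -- list represents a set).
  IsCycleBasis : List (EdgeSet G) → Set
  IsCycleBasis M = All IsCycle M × LinIndep M × SpansCycles M

  weight : List (EdgeSet G) → ℕ
  weight M = sum (map ∣_∣ M)

  IsMCB : List (EdgeSet G) → Set
  IsMCB M = IsCycleBasis M × (∀ M' → IsCycleBasis M' → weight M ≤ weight M')

  Relevant : EdgeSet G → Set
  Relevant C = ∃ λ M → IsMCB M × C ∈ M

  _∼pi_ : EdgeSet G → EdgeSet G → Set
  C₁ ∼pi C₂ = ∃ λ M₂ → IsMCB M₂ × Σ (Fin (length M₂)) λ i →
    Data.List.lookup M₂ i ≡ C₂ × IsMCB (M₂ [ i ]∷= C₁)

-- Reflexivity and symmetry are immediate: put C back in its own place, or
-- undo the exchange.  For transitivity let A be an MCB with C₂ = A i such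
-- that C₁ may replace A i, and B an MCB with C₃ = B j such that C₂ may
-- replace B j; all three cycles then have the same length w, and C₁ has
-- coefficient 1 at i in A, C₂ coefficient 1 at j in B.  Write the elements
-- B l with l in the B-support of C₂ in A-coordinates and keep only the
-- coordinates of A-elements of length w.  A breadth-first search, starting
-- from the support of C₁, either reaches B j = C₃ along an induced chain of
-- overlapping supports, or finds a subfamily containing B j whose length-w
-- coordinates cancel; the latter would put a B-combination involving C₃ into
-- the span of cycles shorter than w, which minimality of B forbids.  Walking
-- along the chain, each element in turn replaces an overlapping length-w
-- element of A, keeping an MCB at every step, and the last step yields an
-- MCB containing C₃ in which C₁ may replace C₃.
module Submission where

open import Defs
open import Algebra.Bundles using (AbelianGroup)
open import Algebra.Structures using (IsAbelianGroup)
import Algebra.Properties.AbelianGroup as AbelianGroupProperties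
import Algebra.Properties.CommutativeSemigroup as CommutativeSemigroupProperties
open import Data.Bool using (true; false; if_then_else_; _xor_)
import Data.Bool.Properties as BoolP
open import Data.Empty using (⊥-elim)
open import Data.Fin as Fin using (Fin; zero; suc; _≟_)
open import Data.Fin.Properties using (any?)
open import Data.Fin.Subset using (Subset; ⊥; ⁅_⁆; _∈_; _∉_; _⊆_; _∩_; _∪_; _-_; Nonempty; Empty; ∣_∣)
open import Data.Fin.Subset.Properties
open import Data.List as L using (List; []; _∷_; length; _[_]∷=_)
open import Data.List.Properties using (length-tabulate; tabulate-lookup; lookup-tabulate; tabulate-cong)
open import Data.List.Relation.Unary.All as All using (All; []; _∷_)
import Data.List.Relation.Unary.All.Properties as AllP
import Data.List.Relation.Unary.Any as Any
open import Data.List.Relation.Unary.Any.Properties using (lookup-index)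
open import Data.Nat as Nat using (ℕ; zero; suc; _≤_; _<_; _+_)
open import Data.Nat.Induction using (<-wellFounded)
import Data.Nat.Properties as NatP
open import Data.Nat.Tactic.RingSolver using (solve-∀)
open import Data.Product using (_×_; _,_; proj₁; proj₂; ∃; Σ)
open import Data.Sum using (_⊎_; inj₁; inj₂; map₂)
open import Data.Vec using ([]; _∷_; here; there; tabulate; cast)
open import Data.Vec.Functional using (updateAt)
open import Data.Vec.Functional.Properties
  using (updateAt-updates; updateAt-minimal; updateAt-updateAt; updateAt-id-local)
import Data.Vec.Properties as VecP
open import Function using (_∘_; const)
open import Induction.WellFounded using (Acc; acc)
open import Level using (0ℓ)
open import Relation.Binary.PropositionalEquality
open import Relation.Nullary using (¬_; Dec; yes; no; does)
open import Relation.Nullary.Decidable using (dec-true; _×-dec_)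
open import Relation.Unary using (Decidable)

private
  variable
    m n : ℕ

-- Subsets of Fin n as the vector space GF(2)ⁿ

⊕-assoc : ∀ (p q r : Subset n) → (p ⊕ q) ⊕ r ≡ p ⊕ (q ⊕ r)
⊕-assoc = VecP.zipWith-assoc BoolP.xor-assoc

⊕-comm : ∀ (p q : Subset n) → p ⊕ q ≡ q ⊕ p
⊕-comm = VecP.zipWith-comm BoolP.xor-comm

⊕-identityˡ : ∀ (p : Subset n) → ⊥ ⊕ p ≡ p
⊕-identityˡ = VecP.zipWith-identityˡ BoolP.xor-identityˡ

⊕-identityʳ : ∀ (p : Subset n) → p ⊕ ⊥ ≡ p
⊕-identityʳ = VecP.zipWith-identityʳ BoolP.xor-identityʳ

⊕-self : ∀ (p : Subset n) → p ⊕ p ≡ ⊥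
⊕-self []       = refl
⊕-self (x ∷ p) = cong₂ _∷_ (BoolP.xor-same x) (⊕-self p)

⊕-isAbelianGroup : IsAbelianGroup {A = Subset n} _≡_ _⊕_ ⊥ (λ p → p)
⊕-isAbelianGroup = record
  { isGroup = record
    { isMonoid = record
      { isSemigroup = record
        { isMagma = record { isEquivalence = isEquivalence ; ∙-cong = cong₂ _⊕_ }
        ; assoc = ⊕-assoc
        }
      ; identity = ⊕-identityˡ , ⊕-identityʳ
      }
    ; inverse = ⊕-self , ⊕-self
    ; ⁻¹-cong = λ p≡q → p≡q
    }
  ; comm = ⊕-comm
  }

⊕-abelianGroup : ℕ → AbelianGroup 0ℓ 0ℓ
⊕-abelianGroup n = record { isAbelianGroup = ⊕-isAbelianGroup {n} }

module _ {n : ℕ} where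
  open AbelianGroupProperties (⊕-abelianGroup n) public
    using () renaming (x∙y⁻¹≈ε⇒x≈y to ⊕≡⊥⇒≡; //-rightDividesʳ to ⊕-cancelʳ)
  open CommutativeSemigroupProperties (AbelianGroup.commutativeSemigroup (⊕-abelianGroup n)) public
    using () renaming (interchange to ⊕-interchange)

x∈p⊕q⁻ : ∀ {x : Fin n} (p q : Subset n) → x ∈ p ⊕ q → x ∈ p ⊎ x ∈ q
x∈p⊕q⁻ (true  ∷ p) (false ∷ q) here        = inj₁ here
x∈p⊕q⁻ (false ∷ p) (true  ∷ q) here        = inj₂ here
x∈p⊕q⁻ (_     ∷ p) (_     ∷ q) (there x∈p⊕q) with x∈p⊕q⁻ p q x∈p⊕q
... | inj₁ x∈p = inj₁ (there x∈p)
... | inj₂ x∈q = inj₂ (there x∈q)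

x∈p∧x∉q⇒x∈p⊕q : ∀ {x : Fin n} {p q : Subset n} → x ∈ p → x ∉ q → x ∈ p ⊕ q
x∈p∧x∉q⇒x∈p⊕q {q = false ∷ q} here       x∉q = here
x∈p∧x∉q⇒x∈p⊕q {q = true  ∷ q} here       x∉q = ⊥-elim (x∉q here)
x∈p∧x∉q⇒x∈p⊕q {q = _     ∷ q} (there x∈p) x∉q = there (x∈p∧x∉q⇒x∈p⊕q x∈p (x∉q ∘ there))

x∉p∧x∈q⇒x∈p⊕q : ∀ {x : Fin n} {p q : Subset n} → x ∉ p → x ∈ q → x ∈ p ⊕ q
x∉p∧x∈q⇒x∈p⊕q {p = p} {q} x∉p x∈q = subst (_ ∈_) (⊕-comm q p) (x∈p∧x∉q⇒x∈p⊕q x∈q x∉p)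

x∈p∩q⇒x∉p⊕q : ∀ {x : Fin n} {p q : Subset n} → x ∈ p → x ∈ q → x ∉ p ⊕ q
x∈p∩q⇒x∉p⊕q here       here       ()
x∈p∩q⇒x∉p⊕q (there x∈p) (there x∈q) (there x∈p⊕q) = x∈p∩q⇒x∉p⊕q x∈p x∈q x∈p⊕q

⊕-∩-distrib : ∀ (w p q : Subset n) → w ∩ (p ⊕ q) ≡ (w ∩ p) ⊕ (w ∩ q)
⊕-∩-distrib = VecP.zipWith-distribˡ BoolP.∧-distribˡ-xor

∩-⊥ : ∀ (w : Subset n) → w ∩ ⊥ ≡ ⊥
∩-⊥ = VecP.zipWith-zeroʳ BoolP.∧-zeroʳ

x∈p⇒p-x≡p⊕⁅x⁆ : ∀ {x : Fin n} {p : Subset n} → x ∈ p → p - x ≡ p ⊕ ⁅ x ⁆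
x∈p⇒p-x≡p⊕⁅x⁆ {p = true ∷ p} here        = cong (false ∷_) (trans (p─⊥≡p p) (sym (⊕-identityʳ p)))
x∈p⇒p-x≡p⊕⁅x⁆ {p = s    ∷ p} (there x∈p) =
  cong₂ _∷_ (sym (BoolP.xor-identityʳ s)) (x∈p⇒p-x≡p⊕⁅x⁆ x∈p)

Empty-∩-antitone : ∀ {p q r : Subset n} → p ⊆ q → Empty (q ∩ r) → Empty (p ∩ r)
Empty-∩-antitone p⊆q q∩r≡∅ (x , x∈p∩r) =
  let x∈p , x∈r = x∈p∩q⁻ _ _ x∈p∩r in q∩r≡∅ (x , x∈p∩q⁺ (p⊆q x∈p , x∈r))

-- Linear combinations

lincomb : (Fin m → Subset n) → Subset m → Subset n
lincomb A []       = ⊥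
lincomb A (c ∷ cs) = (if c then A zero else ⊥) ⊕ lincomb (A ∘ suc) cs

lincomb-⊥ : ∀ (A : Fin m → Subset n) → lincomb A ⊥ ≡ ⊥
lincomb-⊥ {m = zero}  A = refl
lincomb-⊥ {m = suc m} A = trans (⊕-identityˡ _) (lincomb-⊥ (A ∘ suc))

lincomb-⊕ : ∀ (A : Fin m → Subset n) x y → lincomb A (x ⊕ y) ≡ lincomb A x ⊕ lincomb A y
lincomb-⊕ A []      []      = sym (⊕-self ⊥)
lincomb-⊕ A (a ∷ x) (b ∷ y) =
  trans (cong₂ _⊕_ (if-xor a b) (lincomb-⊕ (A ∘ suc) x y)) (⊕-interchange _ _ _ _)
  where
  if-xor : ∀ a b → (if a xor b then A zero else ⊥) ≡ (if a then A zero else ⊥) ⊕ (if b then A zero else ⊥)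
  if-xor true  true  = sym (⊕-self (A zero))
  if-xor true  false = sym (⊕-identityʳ (A zero))
  if-xor false b     = sym (⊕-identityˡ _)

lincomb-⁅⁆ : ∀ (A : Fin m → Subset n) b → lincomb A ⁅ b ⁆ ≡ A b
lincomb-⁅⁆ A zero    = trans (cong (A zero ⊕_) (lincomb-⊥ (A ∘ suc))) (⊕-identityʳ _)
lincomb-⁅⁆ A (suc b) = trans (⊕-identityˡ _) (lincomb-⁅⁆ (A ∘ suc) b)

lincomb-cong : ∀ {A B : Fin m → Subset n} → A ≗ B → lincomb A ≗ lincomb B
lincomb-cong A≗B []       = refl
lincomb-cong A≗B (c ∷ cs) =
  cong₂ (λ p q → (if c then p else ⊥) ⊕ q) (A≗B zero) (lincomb-cong (A≗B ∘ suc) cs)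

lincomb-support : ∀ (A : Fin m → Subset n) c {k} → k ∈ lincomb A c → ∃ λ l → l ∈ c × k ∈ A l
lincomb-support A []          k∈ = ⊥-elim (∉⊥ k∈)
lincomb-support A (true ∷ cs) k∈ with x∈p⊕q⁻ (A zero) (lincomb (A ∘ suc) cs) k∈
... | inj₁ k∈A₀ = zero , here , k∈A₀
... | inj₂ k∈cs with lincomb-support (A ∘ suc) cs k∈cs
...   | l , l∈cs , k∈Al = suc l , there l∈cs , k∈Al
lincomb-support A (false ∷ cs) k∈ with lincomb-support (A ∘ suc) cs (subst (_ ∈_) (⊕-identityˡ _) k∈)
... | l , l∈cs , k∈Al = suc l , there l∈cs , k∈Al

IsLinear : (Subset n → Subset m) → Set
IsLinear f = f ⊥ ≡ ⊥ × (∀ p q → f (p ⊕ q) ≡ f p ⊕ f q)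

linear-lincomb : ∀ {k} {f : Subset n → Subset k} → IsLinear f →
                 ∀ (A : Fin m → Subset n) c → f (lincomb A c) ≡ lincomb (f ∘ A) c
linear-lincomb (f⊥ , f⊕) A []       = f⊥
linear-lincomb {f = f} (f⊥ , f⊕) A (c ∷ cs) =
  trans (f⊕ _ _) (cong₂ _⊕_ (f-if c) (linear-lincomb (f⊥ , f⊕) (A ∘ suc) cs))
  where
  f-if : ∀ c → f (if c then A zero else ⊥) ≡ (if c then f (A zero) else ⊥)
  f-if true  = refl
  f-if false = f⊥

lincomb-lincomb : ∀ {k} (A : Fin m → Subset n) (R : Fin k → Subset m) c →
                  lincomb A (lincomb R c) ≡ lincomb (lincomb A ∘ R) c
lincomb-lincomb A = linear-lincomb (lincomb-⊥ A , lincomb-⊕ A)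

∩-lincomb : ∀ (W : Subset n) (A : Fin m → Subset n) c → W ∩ lincomb A c ≡ lincomb (λ l → W ∩ A l) c
∩-lincomb W = linear-lincomb (∩-⊥ W , ⊕-∩-distrib W)

lincomb-injective : ∀ (A : Fin m → Subset n) → (∀ x → lincomb A x ≡ ⊥ → x ≡ ⊥) →
                    ∀ {x y} → lincomb A x ≡ lincomb A y → x ≡ y
lincomb-injective A independent {x} {y} eq = ⊕≡⊥⇒≡ x y (independent (x ⊕ y) (begin
  lincomb A (x ⊕ y)           ≡⟨ lincomb-⊕ A x y ⟩
  lincomb A x ⊕ lincomb A y   ≡⟨ cong (_⊕ lincomb A y) eq ⟩
  lincomb A y ⊕ lincomb A y   ≡⟨ ⊕-self (lincomb A y) ⟩
  ⊥                           ∎))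
  where open ≡-Reasoning

_[_]≔_ : ∀ {X : Set} → (Fin m → X) → Fin m → X → Fin m → X
A [ b ]≔ C = updateAt A b (const C)

≔-cases : ∀ {X : Set} (A : Fin m → X) b C k → (A [ b ]≔ C) k ≡ C ⊎ (A [ b ]≔ C) k ≡ A k
≔-cases A b C k with k ≟ b
... | yes refl = inj₁ (updateAt-updates b A)
... | no k≢b   = inj₂ (updateAt-minimal k b A k≢b)

lincomb-≔-∉ : ∀ (A : Fin m → Subset n) {b} C {y} → b ∉ y → lincomb (A [ b ]≔ C) y ≡ lincomb A y
lincomb-≔-∉ A {zero}  C {true  ∷ y} b∉y = ⊥-elim (b∉y here)
lincomb-≔-∉ A {zero}  C {false ∷ y} b∉y = refl
lincomb-≔-∉ A {suc b} C {c     ∷ y} b∉y =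
  cong ((if c then A zero else ⊥) ⊕_) (lincomb-≔-∉ (A ∘ suc) C (b∉y ∘ there))

lincomb-≔-∈ : ∀ (A : Fin m → Subset n) {b} C {y} → b ∈ y →
              lincomb (A [ b ]≔ C) y ≡ lincomb A y ⊕ (A b ⊕ C)
lincomb-≔-∈ A {zero} C {true ∷ y} here = begin
  C ⊕ L                         ≡⟨ ⊕-comm C L ⟩
  L ⊕ C                         ≡⟨ ⊕-identityˡ (L ⊕ C) ⟨
  ⊥ ⊕ (L ⊕ C)                   ≡⟨ cong (_⊕ (L ⊕ C)) (⊕-self (A zero)) ⟨
  (A zero ⊕ A zero) ⊕ (L ⊕ C)   ≡⟨ ⊕-interchange (A zero) (A zero) L C ⟩
  (A zero ⊕ L) ⊕ (A zero ⊕ C)   ∎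
  where open ≡-Reasoning
        L = lincomb (A ∘ suc) y
lincomb-≔-∈ A {suc b} C {c ∷ y} (there b∈y) =
  trans (cong ((if c then A zero else ⊥) ⊕_) (lincomb-≔-∈ (A ∘ suc) C b∈y)) (sym (⊕-assoc _ _ _))

lincomb-exchange : ∀ (A : Fin m → Subset n) {b cs y C} → lincomb A cs ≡ C → b ∈ y →
                   lincomb (A [ b ]≔ C) y ≡ lincomb A (y ⊕ (cs ⊕ ⁅ b ⁆))
lincomb-exchange A {b} {cs} {y} {C} hc b∈y = begin
  lincomb (A [ b ]≔ C) y                          ≡⟨ lincomb-≔-∈ A C b∈y ⟩
  Y ⊕ (A b ⊕ C)                                   ≡⟨ cong (Y ⊕_) (⊕-comm (A b) C) ⟩
  Y ⊕ (C ⊕ A b)                                   ≡⟨ cong₂ (λ p q → Y ⊕ (p ⊕ q)) hc (lincomb-⁅⁆ A b) ⟨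
  Y ⊕ (lincomb A cs ⊕ lincomb A ⁅ b ⁆)            ≡⟨ cong (Y ⊕_) (lincomb-⊕ A cs ⁅ b ⁆) ⟨
  Y ⊕ lincomb A (cs ⊕ ⁅ b ⁆)                      ≡⟨ lincomb-⊕ A y _ ⟨
  lincomb A (y ⊕ (cs ⊕ ⁅ b ⁆))                    ∎
  where open ≡-Reasoning
        Y = lincomb A y

∈-exchange : ∀ {b : Fin n} {y cs} → b ∈ y → b ∈ cs → b ∈ y ⊕ (cs ⊕ ⁅ b ⁆)
∈-exchange {b = b} b∈y b∈cs = x∈p∧x∉q⇒x∈p⊕q b∈y (x∈p∩q⇒x∉p⊕q b∈cs (x∈⁅x⁆ b))

exchange-coordinates : ∀ (A : Fin m → Subset n) {b cs C y D} → lincomb A cs ≡ C → b ∈ cs →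
                       lincomb A y ≡ D → b ∈ y → lincomb (A [ b ]≔ C) (y ⊕ (cs ⊕ ⁅ b ⁆)) ≡ D
exchange-coordinates A {b} {cs} {y = y} hc b∈cs hy b∈y =
  trans (lincomb-exchange A hc (∈-exchange b∈y b∈cs))
        (trans (cong (lincomb A) (⊕-cancelʳ (cs ⊕ ⁅ b ⁆) y)) hy)

select : ∀ {P : Fin n → Set} → Decidable P → Subset n
select P? = tabulate (λ k → does (P? k))

∈-select⁺ : ∀ {P : Fin n → Set} (P? : Decidable P) {k} → P k → k ∈ select P?
∈-select⁺ P? {k} p = VecP.lookup⇒[]= k _ (trans (VecP.lookup∘tabulate _ k) (dec-true (P? k) p))

∈-select⁻ : ∀ {P : Fin n → Set} (P? : Decidable P) {k} → k ∈ select P? → P k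
∈-select⁻ P? {k} k∈ with P? k | trans (sym (VecP.lookup∘tabulate _ k)) (VecP.[]=⇒lookup k∈)
... | yes p | _ = p
... | no _  | ()

Nonempty-∪-∩ : ∀ {p q r : Subset n} → Nonempty ((p ∪ q) ∩ r) → Empty (p ∩ r) → Nonempty (q ∩ r)
Nonempty-∪-∩ {p = p} {q} (i , i∈) pr≡∅ with x∈p∩q⁻ _ _ i∈
... | i∈p∪q , i∈r with x∈p∪q⁻ p q i∈p∪q
...   | inj₁ i∈p = ⊥-elim (pr≡∅ (i , x∈p∩q⁺ (i∈p , i∈r)))
...   | inj₂ i∈q = i , x∈p∩q⁺ (i∈q , i∈r)

module _ {W p q r : Subset n} {b : Fin n} where

  exchange-Nonempty : b ∈ p → Empty ((W ∩ p) ∩ r) → Nonempty ((W ∩ q) ∩ r) →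
                      Nonempty ((W ∩ (p ⊕ (q ⊕ ⁅ b ⁆))) ∩ r)
  exchange-Nonempty b∈p Wpr≡∅ (i , i∈Wqr) =
    i , x∈p∩q⁺ (x∈p∩q⁺ (i∈W , x∉p∧x∈q⇒x∈p⊕q i∉p i∈q⊕⁅b⁆) , i∈r)
    where
    i∈Wq = proj₁ (x∈p∩q⁻ _ _ i∈Wqr)
    i∈r  = proj₂ (x∈p∩q⁻ _ _ i∈Wqr)
    i∈W  = proj₁ (x∈p∩q⁻ _ _ i∈Wq)
    i∈q  = proj₂ (x∈p∩q⁻ _ _ i∈Wq)
    i∉p : i ∉ p
    i∉p i∈p = Wpr≡∅ (i , x∈p∩q⁺ (x∈p∩q⁺ (i∈W , i∈p) , i∈r))
    i≢b : i ≢ b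
    i≢b refl = i∉p b∈p
    i∈q⊕⁅b⁆ = x∈p∧x∉q⇒x∈p⊕q i∈q (x≢y⇒x∉⁅y⁆ i≢b)

  exchange-Empty : b ∈ W ∩ p → Empty ((W ∩ p) ∩ r) → Empty ((W ∩ q) ∩ r) →
                   Empty ((W ∩ (p ⊕ (q ⊕ ⁅ b ⁆))) ∩ r)
  exchange-Empty b∈Wp Wpr≡∅ Wqr≡∅ (i , i∈) with x∈p∩q⁻ _ _ i∈
  ... | i∈W′ , i∈r with x∈p∩q⁻ _ _ i∈W′
  ...   | i∈W , i∈p⊕ with x∈p⊕q⁻ p _ i∈p⊕
  ...     | inj₁ i∈p = Wpr≡∅ (i , x∈p∩q⁺ (x∈p∩q⁺ (i∈W , i∈p) , i∈r))
  ...     | inj₂ i∈q⊕ with x∈p⊕q⁻ q _ i∈q⊕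
  ...       | inj₁ i∈q = Wqr≡∅ (i , x∈p∩q⁺ (x∈p∩q⁺ (i∈W , i∈q) , i∈r))
  ...       | inj₂ i∈⁅b⁆ with x∈⁅y⁆⇒x≡y b i∈⁅b⁆
  ...         | refl = Wpr≡∅ (b , x∈p∩q⁺ (b∈Wp , i∈r))

-- Induced chains of overlapping subsets

module InducedChains {m n : ℕ} (v : Fin m → Subset n) (u : Fin m) where

  data Chain : Fin m → List (Fin m) → Set where
    end  : Chain u []
    link : ∀ {k k′ ks} → Nonempty (v k ∩ v k′) → All (λ l → Empty (v k ∩ v l)) ks →
           Chain k′ ks → Chain k (k′ ∷ ks)

  Entry : Subset n → Fin m → List (Fin m) → Set
  Entry T k ks = Nonempty (T ∩ v k) × All (λ l → Empty (T ∩ v l)) ks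

  Route : Subset m → Subset n → Set
  Route D T = ∃ λ k → ∃ λ ks → All (_∈ D) (k ∷ ks) × Entry T k ks × Chain k ks

  Dependency : Subset m → Set
  Dependency D = ∃ λ es → es ⊆ D × u ∈ es × lincomb v es ≡ ⊥

  route-∪ : ∀ {D T d} → d ∈ D → Nonempty (T ∩ v d) → Route D (T ∪ v d) → Route D T
  route-∪ {T = T} d∈D Td≢∅ (k , ks , ks⊆D , (T′k≢∅ , T′ks≡∅) , chain) with nonempty? (T ∩ v k)
  ... | yes Tk≢∅ = k , ks , ks⊆D , (Tk≢∅ , All.map (Empty-∩-antitone (p⊆p∪q _)) T′ks≡∅) , chain
  ... | no  Tk≡∅ = _ , k ∷ ks , d∈D ∷ ks⊆D ,
                   (Td≢∅ , Tk≡∅ ∷ All.map (Empty-∩-antitone (p⊆p∪q _)) T′ks≡∅) ,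
                   link (Nonempty-∪-∩ T′k≢∅ Tk≡∅)
                        (All.map (Empty-∩-antitone (q⊆p∪q T _)) T′ks≡∅) chain

  lincomb-remove-⊆ : ∀ {R T d} → d ∈ R → lincomb v R ⊆ T → lincomb v (R - d) ⊆ T ∪ v d
  lincomb-remove-⊆ {R} {T} {d} d∈R vR⊆T {i} i∈
    rewrite x∈p⇒p-x≡p⊕⁅x⁆ d∈R | lincomb-⊕ v R ⁅ d ⁆ | lincomb-⁅⁆ v d
    with x∈p⊕q⁻ (lincomb v R) (v d) i∈
  ... | inj₁ i∈vR = p⊆p∪q (v d) (vR⊆T i∈vR)
  ... | inj₂ i∈vd = q⊆p∪q T (v d) i∈vd

  -- Keep absorbing into T every v d (d ∈ R) that meets it, until T meets v u.
  -- If this gets stuck, lincomb v R lies inside T yet is disjoint from it.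
  dependency-or-route : ∀ D T → u ∈ D → lincomb v D ⊆ T → Dependency D ⊎ Route D T
  dependency-or-route D = search D (<-wellFounded ∣ D ∣) (λ d∈D → d∈D)
    where
    search : ∀ R → Acc _<_ ∣ R ∣ → R ⊆ D →
             ∀ T → u ∈ R → lincomb v R ⊆ T → Dependency D ⊎ Route D T
    search R (acc smaller) R⊆D T u∈R vR⊆T with nonempty? (T ∩ v u)
    ... | yes Tu≢∅ = inj₂ (u , [] , R⊆D u∈R ∷ [] , (Tu≢∅ , []) , end)
    ... | no Tu≡∅ with any? (λ d → d ∈? R ×-dec nonempty? (T ∩ v d))
    ...   | no none = inj₁ (R , R⊆D , u∈R , Empty-unique vR≡∅)
      where
      vR≡∅ : Empty (lincomb v R)
      vR≡∅ (i , i∈vR) with lincomb-support v R i∈vR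
      ... | l , l∈R , i∈vl = none (l , l∈R , i , x∈p∩q⁺ (vR⊆T i∈vR , i∈vl))
    ...   | yes (d , d∈R , Td≢∅) =
      map₂ (route-∪ (R⊆D d∈R) Td≢∅)
        (search (R - d) (smaller (x∈p⇒∣p-x∣<∣p∣ d∈R)) (R⊆D ∘ p─q⊆p R _) (T ∪ v d)
                (x∈p∧x≢y⇒x∈p-y u∈R u≢d) (lincomb-remove-⊆ d∈R vR⊆T))
      where
      u≢d : u ≢ d
      u≢d refl = Tu≡∅ Td≢∅

-- Minimum cycle bases as indexed families

∷=-tabulate-lookup : ∀ {X : Set} (M : List X) i C → M [ i ]∷= C ≡ L.tabulate (L.lookup M [ i ]≔ C)
∷=-tabulate-lookup (B ∷ M) zero    C = cong (C ∷_) (sym (tabulate-lookup M))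
∷=-tabulate-lookup (B ∷ M) (suc i) C = cong (B ∷_) (∷=-tabulate-lookup M i C)

tabulate-∷= : ∀ {X : Set} (A : Fin n → X) b C →
              L.tabulate A [ Fin.cast (sym (length-tabulate A)) b ]∷= C ≡ L.tabulate (A [ b ]≔ C)
tabulate-∷= A zero    C = refl
tabulate-∷= A (suc b) C = cong (A zero ∷_) (tabulate-∷= (A ∘ suc) b C)

cast-⊥ : ∀ {m n} .(eq : m ≡ n) → cast eq (⊥ {m}) ≡ ⊥
cast-⊥ {zero}  {zero}  eq = refl
cast-⊥ {suc m} {suc n} eq = cong (false ∷_) (cast-⊥ {m} {n} (cong Nat.pred eq))

cast-cast : ∀ {m n} .(eq : m ≡ n) .(eq′ : n ≡ m) (x : Subset n) → cast eq (cast eq′ x) ≡ x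
cast-cast eq eq′ x = trans (VecP.cast-trans eq′ eq x) (VecP.cast-is-id _ x)

-- Bases are families indexed by Fin n rather than lists, so that exchanging
-- an element leaves the type of coordinate vectors unchanged.
module CycleSpace (G : Graph) where

  record IsBasis (A : Fin n → EdgeSet G) : Set where
    field
      cycles      : ∀ k → IsCycle G (A k)
      independent : ∀ x → lincomb A x ≡ ⊥ → x ≡ ⊥
      spans       : ∀ C → IsCycle G C → ∃ λ x → lincomb A x ≡ C

    coordinates : ∀ C → IsCycle G C → Subset n
    coordinates C C-cycle = proj₁ (spans C C-cycle)

    lincomb-coordinates : ∀ C (C-cycle : IsCycle G C) → lincomb A (coordinates C C-cycle) ≡ C
    lincomb-coordinates C C-cycle = proj₂ (spans C C-cycle)

  open IsBasis

  weightOf : (Fin n → EdgeSet G) → ℕ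
  weightOf A = weight G (L.tabulate A)

  record IsMinimumBasis (A : Fin n → EdgeSet G) : Set where
    field
      isBasis : IsBasis A
      minimal : ∀ M → IsCycleBasis G M → weightOf A ≤ weight G M

  open IsMinimumBasis

  -- length (tabulate A) is only propositionally n, hence the casts.
  combo-tabulate : ∀ (A : Fin n → EdgeSet G) cs →
                   combo G (L.tabulate A) cs ≡ lincomb A (cast (length-tabulate A) cs)
  combo-tabulate {n = zero}  A []       = refl
  combo-tabulate {n = suc n} A (c ∷ cs) = cong ((if c then A zero else ⊥) ⊕_) (combo-tabulate (A ∘ suc) cs)

  combo-tabulate-cast : ∀ (A : Fin n → EdgeSet G) x →
                        combo G (L.tabulate A) (cast (sym (length-tabulate A)) x) ≡ lincomb A x
  combo-tabulate-cast A x = trans (combo-tabulate A _) (cong (lincomb A) (cast-cast _ _ x))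

  module _ {A : Fin n → EdgeSet G} where

    isBasis⇒isCycleBasis : IsBasis A → IsCycleBasis G (L.tabulate A)
    isBasis⇒isCycleBasis A-basis = AllP.tabulate⁺ (cycles A-basis) , independent′ , spans′
      where
      eq = length-tabulate A
      independent′ : LinIndep G (L.tabulate A)
      independent′ cs h = begin
        cs                          ≡⟨ cast-cast (sym eq) eq cs ⟨
        cast (sym eq) (cast eq cs)  ≡⟨ cong (cast (sym eq)) (independent A-basis _ h′) ⟩
        cast (sym eq) ⊥             ≡⟨ cast-⊥ (sym eq) ⟩
        ⊥                           ∎
        where
        open ≡-Reasoning
        h′ = trans (sym (combo-tabulate A cs)) h
      spans′ : SpansCycles G (L.tabulate A)
      spans′ C C-cycle = _ , trans (combo-tabulate-cast A x) (lincomb-coordinates A-basis C C-cycle)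
        where x = coordinates A-basis C C-cycle

    isCycleBasis⇒isBasis : IsCycleBasis G (L.tabulate A) → IsBasis A
    isCycleBasis⇒isBasis (all-cycles , linIndep , spansCycles) = record
      { cycles      = AllP.tabulate⁻ all-cycles
      ; independent = independent′
      ; spans       = λ C C-cycle → let cs , h = spansCycles C C-cycle in
                        cast eq cs , trans (sym (combo-tabulate A cs)) h
      }
      where
      eq = length-tabulate A
      independent′ : ∀ x → lincomb A x ≡ ⊥ → x ≡ ⊥
      independent′ x h = begin
        x                          ≡⟨ cast-cast eq (sym eq) x ⟨
        cast eq (cast (sym eq) x)  ≡⟨ cong (cast eq) (linIndep _ (trans (combo-tabulate-cast A x) h)) ⟩
        cast eq ⊥                  ≡⟨ cast-⊥ eq ⟩
        ⊥                          ∎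
        where open ≡-Reasoning

    isMinimumBasis⇒isMCB : IsMinimumBasis A → IsMCB G (L.tabulate A)
    isMinimumBasis⇒isMCB A-min = isBasis⇒isCycleBasis (isBasis A-min) , minimal A-min

    isMCB⇒isMinimumBasis : IsMCB G (L.tabulate A) → IsMinimumBasis A
    isMCB⇒isMinimumBasis (A-basis , A-minimal) = record
      { isBasis = isCycleBasis⇒isBasis A-basis ; minimal = A-minimal }

  lookup-isMinimumBasis : ∀ {M} → IsMCB G M → IsMinimumBasis (L.lookup M)
  lookup-isMinimumBasis {M} M-mcb = isMCB⇒isMinimumBasis (subst (IsMCB G) (sym (tabulate-lookup M)) M-mcb)

  module _ {A : Fin n → EdgeSet G} {C : EdgeSet G} {b : Fin n} where

    exchange-isBasis : ∀ {cs} → IsBasis A → IsCycle G C → lincomb A cs ≡ C → b ∈ cs → IsBasis (A [ b ]≔ C)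
    exchange-isBasis {cs} A-basis C-cycle hc b∈cs = record
      { cycles = cycles′ ; independent = independent′ ; spans = spans′ }
      where
      cycles′ : ∀ k → IsCycle G ((A [ b ]≔ C) k)
      cycles′ k with ≔-cases A b C k
      ... | inj₁ eq = subst (IsCycle G) (sym eq) C-cycle
      ... | inj₂ eq = subst (IsCycle G) (sym eq) (cycles A-basis k)
      independent′ : ∀ y → lincomb (A [ b ]≔ C) y ≡ ⊥ → y ≡ ⊥
      independent′ y h with b ∈? y
      ... | no  b∉y = independent A-basis y (trans (sym (lincomb-≔-∉ A C b∉y)) h)
      ... | yes b∈y = ⊥-elim (∉⊥ (subst (b ∈_) y′≡⊥ (∈-exchange b∈y b∈cs)))
        where y′≡⊥ = independent A-basis _ (trans (sym (lincomb-exchange A hc b∈y)) h)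
      spans′ : ∀ D → IsCycle G D → ∃ λ y → lincomb (A [ b ]≔ C) y ≡ D
      spans′ D D-cycle with coordinates A-basis D D-cycle | lincomb-coordinates A-basis D D-cycle
      ... | y | hy with b ∈? y
      ...   | no  b∉y = y , trans (lincomb-≔-∉ A C b∉y) hy
      ...   | yes b∈y = y ⊕ (cs ⊕ ⁅ b ⁆) , exchange-coordinates A hc b∈cs hy b∈y

    exchange-coefficient : ∀ {cs} → IsBasis (A [ b ]≔ C) → lincomb A cs ≡ C → b ∈ cs
    exchange-coefficient {cs} A′-basis hc with b ∈? cs
    ... | yes b∈cs = b∈cs
    ... | no  b∉cs = ⊥-elim (∉⊥ (subst (b ∈_) (independent A′-basis y (begin
      lincomb (A [ b ]≔ C) y               ≡⟨ lincomb-exchange A hc b∈y ⟩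
      lincomb A (y ⊕ y)                    ≡⟨ cong (lincomb A) (⊕-self y) ⟩
      lincomb A ⊥                          ≡⟨ lincomb-⊥ A ⟩
      ⊥                                    ∎)) b∈y))
      where
      open ≡-Reasoning
      y = cs ⊕ ⁅ b ⁆
      b∈y = x∉p∧x∈q⇒x∈p⊕q b∉cs (x∈⁅x⁆ b)

  weightOf-≔ : ∀ (A : Fin n → EdgeSet G) b C → weightOf (A [ b ]≔ C) + ∣ A b ∣ ≡ weightOf A + ∣ C ∣
  weightOf-≔ A zero    C = rotate (∣ C ∣) (weightOf (A ∘ suc)) (∣ A zero ∣)
    where
    rotate : ∀ a b c → (a + b) + c ≡ (c + b) + a
    rotate = solve-∀
  weightOf-≔ A (suc b) C = begin
    (∣ A zero ∣ + weightOf ((A ∘ suc) [ b ]≔ C)) + ∣ A (suc b) ∣  ≡⟨ NatP.+-assoc ∣ A zero ∣ _ _ ⟩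
    ∣ A zero ∣ + (weightOf ((A ∘ suc) [ b ]≔ C) + ∣ A (suc b) ∣)  ≡⟨ cong (∣ A zero ∣ +_) (weightOf-≔ (A ∘ suc) b C) ⟩
    ∣ A zero ∣ + (weightOf (A ∘ suc) + ∣ C ∣)                      ≡⟨ NatP.+-assoc ∣ A zero ∣ _ _ ⟨
    (∣ A zero ∣ + weightOf (A ∘ suc)) + ∣ C ∣                      ∎
    where open ≡-Reasoning

  isMinimumBasis-resp-≗ : ∀ {A B : Fin n → EdgeSet G} → A ≗ B → IsMinimumBasis A → IsMinimumBasis B
  isMinimumBasis-resp-≗ {A = A} {B} A≗B A-min = record
    { isBasis = record
      { cycles      = λ k → subst (IsCycle G) (A≗B k) (cycles (isBasis A-min) k)
      ; independent = λ x h → independent (isBasis A-min) x (trans (lincomb-cong A≗B x) h)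
      ; spans       = λ C C-cycle → let x = coordinates (isBasis A-min) C C-cycle in
                        x , trans (sym (lincomb-cong A≗B x)) (lincomb-coordinates (isBasis A-min) C C-cycle)
      }
    ; minimal = λ M M-basis → subst (_≤ weight G M) (cong (weight G) (tabulate-cong A≗B)) (minimal A-min M M-basis)
    }

  module _ {A : Fin n → EdgeSet G} {C : EdgeSet G} {b : Fin n} (A-min : IsMinimumBasis A) where

    -- Otherwise exchanging A b for C would produce a lighter basis.
    support-weight : ∀ {cs} → IsCycle G C → lincomb A cs ≡ C → b ∈ cs → ∣ A b ∣ ≤ ∣ C ∣
    support-weight C-cycle hc b∈cs = NatP.≮⇒≥ λ ∣C∣<∣Ab∣ →
      NatP.<-irrefl (sym (weightOf-≔ A b C)) (NatP.+-mono-≤-< (minimal A-min _ A′-basis) ∣C∣<∣Ab∣)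
      where A′-basis = isBasis⇒isCycleBasis (exchange-isBasis (isBasis A-min) C-cycle hc b∈cs)

    exchange-weight : IsMinimumBasis (A [ b ]≔ C) → ∣ C ∣ ≡ ∣ A b ∣
    exchange-weight A′-min = NatP.+-cancelˡ-≡ (weightOf A) _ _ (begin
      weightOf A + ∣ C ∣               ≡⟨ weightOf-≔ A b C ⟨
      weightOf (A [ b ]≔ C) + ∣ A b ∣  ≡⟨ cong (_+ ∣ A b ∣) same-weight ⟩
      weightOf A + ∣ A b ∣             ∎)
      where
      open ≡-Reasoning
      same-weight = NatP.≤-antisym (minimal A′-min _ (isBasis⇒isCycleBasis (isBasis A-min)))
                                   (minimal A-min _ (isBasis⇒isCycleBasis (isBasis A′-min)))

    exchange-isMinimumBasis : ∀ {cs} → IsCycle G C → lincomb A cs ≡ C → b ∈ cs → ∣ C ∣ ≡ ∣ A b ∣ →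
                              IsMinimumBasis (A [ b ]≔ C)
    exchange-isMinimumBasis C-cycle hc b∈cs ∣C∣≡∣Ab∣ = record
      { isBasis = exchange-isBasis (isBasis A-min) C-cycle hc b∈cs
      ; minimal = λ M M-basis → subst (_≤ weight G M) (sym same-weight) (minimal A-min M M-basis)
      }
      where
      same-weight = NatP.+-cancelʳ-≡ ∣ A b ∣ _ _
                      (trans (weightOf-≔ A b C) (cong (weightOf A +_) ∣C∣≡∣Ab∣))

  support-weight-< : ∀ {m w} {B : Fin m → EdgeSet G} {A : Fin n → EdgeSet G} {c e j} →
                     IsMinimumBasis B → (∀ k → IsCycle G (A k)) → (∀ {k} → k ∈ c → ∣ A k ∣ < w) →
                     lincomb B e ≡ lincomb A c → j ∈ e → ∣ B j ∣ < w
  support-weight-< {w = w} {B} {A} {c} {e} {j} B-min A-cycles light eq j∈e =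
    via-support (lincomb-support r c (subst (j ∈_) e≡rc j∈e))
    where
    r = λ k → coordinates (isBasis B-min) (A k) (A-cycles k)
    lincomb-r : ∀ k → lincomb B (r k) ≡ A k
    lincomb-r k = lincomb-coordinates (isBasis B-min) (A k) (A-cycles k)
    e≡rc : e ≡ lincomb r c
    e≡rc = lincomb-injective B (independent (isBasis B-min)) (begin
      lincomb B e                  ≡⟨ eq ⟩
      lincomb A c                  ≡⟨ lincomb-cong lincomb-r c ⟨
      lincomb (lincomb B ∘ r) c    ≡⟨ lincomb-lincomb B r c ⟨
      lincomb B (lincomb r c)      ∎)
      where open ≡-Reasoning
    via-support : (∃ λ k → k ∈ c × j ∈ r k) → ∣ B j ∣ < w
    via-support (k , k∈c , j∈rk) = NatP.≤-<-trans (support-weight B-min (A-cycles k) (lincomb-r k) j∈rk) (light k∈c)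

  -- Polyhedron-interchangeability

  Interchangeable : EdgeSet G → EdgeSet G → Set
  Interchangeable C₁ C₂ = ∃ λ n → Σ (Fin n → EdgeSet G) λ A → Σ (Fin n) λ b →
    IsMinimumBasis A × A b ≡ C₂ × IsMinimumBasis (A [ b ]≔ C₁)

  ∼pi⇒Interchangeable : ∀ {C₁ C₂} → _∼pi_ G C₁ C₂ → Interchangeable C₁ C₂
  ∼pi⇒Interchangeable (M , M-mcb , i , Mi≡C₂ , M′-mcb) =
    length M , L.lookup M , i , lookup-isMinimumBasis M-mcb , Mi≡C₂ ,
    isMCB⇒isMinimumBasis (subst (IsMCB G) (∷=-tabulate-lookup M i _) M′-mcb)

  Interchangeable⇒∼pi : ∀ {C₁ C₂} → Interchangeable C₁ C₂ → _∼pi_ G C₁ C₂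
  Interchangeable⇒∼pi (n , A , b , A-min , Ab≡C₂ , A′-min) =
    L.tabulate A , isMinimumBasis⇒isMCB A-min , _ , trans (lookup-tabulate A b) Ab≡C₂ ,
    subst (IsMCB G) (sym (tabulate-∷= A b _)) (isMinimumBasis⇒isMCB A′-min)

  Interchangeable-refl : ∀ {C} → Relevant G C → Interchangeable C C
  Interchangeable-refl (M , M-mcb , C∈M) =
    length M , L.lookup M , Any.index C∈M , M-min , sym (lookup-index C∈M) ,
    isMinimumBasis-resp-≗ (sym ∘ updateAt-id-local (Any.index C∈M) (L.lookup M) (lookup-index C∈M)) M-min
    where M-min = lookup-isMinimumBasis M-mcb

  Interchangeable-sym : ∀ {C₁ C₂} → Interchangeable C₁ C₂ → Interchangeable C₂ C₁
  Interchangeable-sym (n , A , b , A-min , Ab≡C₂ , A′-min) =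
    n , _ , b , A′-min , updateAt-updates b A ,
    isMinimumBasis-resp-≗ (λ k → sym (trans (updateAt-updateAt b A k) (updateAt-id-local b A (sym Ab≡C₂) k)))
                          A-min

  module Walk {m w : ℕ} (W : Subset n) {x : EdgeSet G} (x-cycle : IsCycle G x) (∣x∣≡w : ∣ x ∣ ≡ w)
              (S : Fin m → EdgeSet G) (S-cycles : ∀ l → IsCycle G (S l)) (R : Fin m → Subset n) (u : Fin m) where

    open InducedChains (λ l → W ∩ R l) u

    Represented : (Fin n → EdgeSet G) → Fin m → Set
    Represented A l = lincomb A (R l) ≡ S l × ∣ S l ∣ ≤ w

    record Pivot (cx : Subset n) (k : Fin m) : Set where
      constructor pivotAt
      field
        b    : Fin n
        b∈W  : b ∈ W
        b∈cx : b ∈ cx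
        b∈Rk : b ∈ R k

    pivot : ∀ {cx k} → Nonempty ((W ∩ cx) ∩ (W ∩ R k)) → Pivot cx k
    pivot (b , b∈) =
      pivotAt b (proj₁ (x∈p∩q⁻ _ _ b∈Wcx)) (proj₂ (x∈p∩q⁻ _ _ b∈Wcx)) (proj₂ (x∈p∩q⁻ _ _ b∈WRk))
      where
      b∈Wcx = proj₁ (x∈p∩q⁻ _ _ b∈)
      b∈WRk = proj₂ (x∈p∩q⁻ _ _ b∈)

    -- Exchanging the pivot A b for S k keeps the coordinates R l of the later
    -- chain elements valid, because the chain conditions force b ∉ R l.
    module Step {A : Fin n → EdgeSet G} {cx k} (A-min : IsMinimumBasis A) (A-W : ∀ {i} → i ∈ W → ∣ A i ∣ ≡ w)
                (hx : lincomb A cx ≡ x) (Sk-rep : Represented A k) (p : Pivot cx k) where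

      open Pivot p public

      ∣Sk∣≡∣Ab∣ : ∣ S k ∣ ≡ ∣ A b ∣
      ∣Sk∣≡∣Ab∣ = NatP.≤-antisym (subst (∣ S k ∣ ≤_) (sym (A-W b∈W)) (proj₂ Sk-rep))
                                 (support-weight A-min (S-cycles k) (proj₁ Sk-rep) b∈Rk)

      A′ : Fin n → EdgeSet G
      A′ = A [ b ]≔ S k

      A′-min : IsMinimumBasis A′
      A′-min = exchange-isMinimumBasis A-min (S-cycles k) (proj₁ Sk-rep) b∈Rk ∣Sk∣≡∣Ab∣

      A′-W : ∀ {i} → i ∈ W → ∣ A′ i ∣ ≡ w
      A′-W {i} i∈W with ≔-cases A b (S k) i
      ... | inj₁ eq = trans (cong ∣_∣ eq) (trans ∣Sk∣≡∣Ab∣ (A-W b∈W))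
      ... | inj₂ eq = trans (cong ∣_∣ eq) (A-W i∈W)

      cx′ : Subset n
      cx′ = cx ⊕ (R k ⊕ ⁅ b ⁆)

      hx′ : lincomb A′ cx′ ≡ x
      hx′ = exchange-coordinates A (proj₁ Sk-rep) b∈Rk hx b∈cx

      represented′ : ∀ {l} → Represented A l × Empty ((W ∩ cx) ∩ (W ∩ R l)) → Represented A′ l
      represented′ ((hl , ∣Sl∣≤w) , Tl≡∅) = trans (lincomb-≔-∉ A (S k) b∉Rl) hl , ∣Sl∣≤w
        where
        b∉Rl : b ∉ R _
        b∉Rl b∈Rl = Tl≡∅ (b , x∈p∩q⁺ (x∈p∩q⁺ (b∈W , b∈cx) , x∈p∩q⁺ (b∈W , b∈Rl)))

      entry′ : ∀ {k′ ks} →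
               Empty ((W ∩ cx) ∩ (W ∩ R k′)) → All (λ l → Empty ((W ∩ cx) ∩ (W ∩ R l))) ks →
               Nonempty ((W ∩ R k) ∩ (W ∩ R k′)) → All (λ l → Empty ((W ∩ R k) ∩ (W ∩ R l))) ks →
               Entry (W ∩ cx′) k′ ks
      entry′ Tk′≡∅ T-disjoint vk∩vk′≢∅ vk-disjoint =
        exchange-Nonempty b∈cx Tk′≡∅ vk∩vk′≢∅ ,
        All.zipWith (λ (Tl≡∅ , vkl≡∅) → exchange-Empty (x∈p∩q⁺ (b∈W , b∈cx)) Tl≡∅ vkl≡∅)
                    (T-disjoint , vk-disjoint)

      x-at-pivot : IsMinimumBasis (A′ [ b ]≔ x)
      x-at-pivot = isMinimumBasis-resp-≗ (λ i → sym (updateAt-updateAt b A i))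
                     (exchange-isMinimumBasis A-min x-cycle hx b∈cx (trans ∣x∣≡w (sym (A-W b∈W))))

    walk : ∀ {k ks} → Chain k ks → ∀ {A} cx → IsMinimumBasis A → (∀ {i} → i ∈ W → ∣ A i ∣ ≡ w) →
           lincomb A cx ≡ x → All (Represented A) (k ∷ ks) → Entry (W ∩ cx) k ks → Interchangeable x (S u)
    walk end {A} cx A-min A-W hx (Su-rep ∷ []) (T∩vu≢∅ , []) =
      n , A′ , b , A′-min , updateAt-updates b A , x-at-pivot
      where open Step A-min A-W hx Su-rep (pivot T∩vu≢∅)
    walk (link vk∩vk′≢∅ vk-disjoint chain) cx A-min A-W hx (Sk-rep ∷ reps)
         (T∩vk≢∅ , Tk′≡∅ ∷ T-disjoint) =
      walk chain cx′ A′-min A′-W hx′ (All.zipWith represented′ (reps , Tk′≡∅ ∷ T-disjoint))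
           (entry′ Tk′≡∅ T-disjoint vk∩vk′≢∅ vk-disjoint)
      where open Step A-min A-W hx Sk-rep (pivot T∩vk≢∅)

  module Transitivity {n m} {C₁ C₂ C₃ : EdgeSet G}
    {A : Fin n → EdgeSet G} {i : Fin n}
    (A-min : IsMinimumBasis A) (Ai≡C₂ : A i ≡ C₂) (A′-min : IsMinimumBasis (A [ i ]≔ C₁))
    {B : Fin m → EdgeSet G} {j : Fin m}
    (B-min : IsMinimumBasis B) (Bj≡C₃ : B j ≡ C₃) (B′-min : IsMinimumBasis (B [ j ]≔ C₂)) where

    w = ∣ C₂ ∣
    A-basis = isBasis A-min
    B-basis = isBasis B-min

    C₁-cycle : IsCycle G C₁
    C₁-cycle = subst (IsCycle G) (updateAt-updates i A) (cycles (isBasis A′-min) i)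

    C₂-cycle : IsCycle G C₂
    C₂-cycle = subst (IsCycle G) Ai≡C₂ (cycles A-basis i)

    x₁ = coordinates A-basis C₁ C₁-cycle
    d  = coordinates B-basis C₂ C₂-cycle

    i∈x₁ : i ∈ x₁
    i∈x₁ = exchange-coefficient (isBasis A′-min) (lincomb-coordinates A-basis C₁ C₁-cycle)

    j∈d : j ∈ d
    j∈d = exchange-coefficient (isBasis B′-min) (lincomb-coordinates B-basis C₂ C₂-cycle)

    R : Fin m → Subset n
    R l = coordinates A-basis (B l) (cycles B-basis l)

    lincomb-R : ∀ l → lincomb A (R l) ≡ B l
    lincomb-R l = lincomb-coordinates A-basis (B l) (cycles B-basis l)

    change-of-basis : ∀ e → lincomb A (lincomb R e) ≡ lincomb B e
    change-of-basis e = trans (lincomb-lincomb A R e) (lincomb-cong lincomb-R e)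

    lincomb-R-d : lincomb R d ≡ ⁅ i ⁆
    lincomb-R-d = lincomb-injective A (independent A-basis) (begin
      lincomb A (lincomb R d)  ≡⟨ change-of-basis d ⟩
      lincomb B d              ≡⟨ lincomb-coordinates B-basis C₂ C₂-cycle ⟩
      C₂                       ≡⟨ Ai≡C₂ ⟨
      A i                      ≡⟨ lincomb-⁅⁆ A i ⟨
      lincomb A ⁅ i ⁆          ∎)
      where open ≡-Reasoning

    support-d : ∀ {l} → l ∈ d → ∣ B l ∣ ≤ w
    support-d = support-weight B-min C₂-cycle (lincomb-coordinates B-basis C₂ C₂-cycle)

    weight-w? : ∀ k → Dec (∣ A k ∣ ≡ w)
    weight-w? k = ∣ A k ∣ Nat.≟ w

    W : Subset n
    W = select weight-w?

    v : Fin m → Subset n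
    v l = W ∩ R l

    open InducedChains v j

    lincomb-v-d : lincomb v d ≡ W ∩ ⁅ i ⁆
    lincomb-v-d = trans (sym (∩-lincomb W R d)) (cong (W ∩_) lincomb-R-d)

    start : lincomb v d ⊆ W ∩ x₁
    start {k} k∈vd with x∈p∩q⁻ W ⁅ i ⁆ (subst (k ∈_) lincomb-v-d k∈vd)
    ... | k∈W , k∈⁅i⁆ with x∈⁅y⁆⇒x≡y i k∈⁅i⁆
    ...   | refl = x∈p∩q⁺ (k∈W , i∈x₁)

    -- A dependency would express ∑ B l (l ∈ es), in which B j of length w
    -- occurs, through A-elements shorter than w.
    no-dependency : ¬ Dependency d
    no-dependency (es , es⊆d , j∈es , ves≡⊥) =
      NatP.<-irrefl (sym (exchange-weight B-min B′-min))
        (support-weight-< B-min (cycles A-basis) light (sym (change-of-basis es)) j∈es)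
      where
      light : ∀ {k} → k ∈ lincomb R es → ∣ A k ∣ < w
      light {k} k∈c with lincomb-support R es k∈c
      ... | l , l∈es , k∈Rl = NatP.≤∧≢⇒<
        (NatP.≤-trans (support-weight A-min (cycles B-basis l) (lincomb-R l) k∈Rl) (support-d (es⊆d l∈es)))
        (λ ∣Ak∣≡w → ∉⊥ (subst (k ∈_) W∩c≡⊥ (x∈p∩q⁺ (∈-select⁺ weight-w? ∣Ak∣≡w , k∈c))))
        where W∩c≡⊥ = trans (∩-lincomb W R es) ves≡⊥

    result : Interchangeable C₁ C₃
    result with dependency-or-route d (W ∩ x₁) j∈d start
    ... | inj₁ dependency = ⊥-elim (no-dependency dependency)
    ... | inj₂ (k , ks , ks⊆d , entry , chain) =
      subst (Interchangeable C₁) Bj≡C₃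
        (walk chain x₁ A-min (∈-select⁻ weight-w?) (lincomb-coordinates A-basis C₁ C₁-cycle)
              (All.map (λ {l} l∈d → lincomb-R l , support-d l∈d) ks⊆d) entry)
      where
      ∣C₁∣≡w = trans (exchange-weight A-min A′-min) (cong ∣_∣ Ai≡C₂)
      open Walk W {C₁} C₁-cycle ∣C₁∣≡w B (cycles B-basis) R j

  Interchangeable-trans : ∀ {C₁ C₂ C₃} →
                          Interchangeable C₁ C₂ → Interchangeable C₂ C₃ → Interchangeable C₁ C₃
  Interchangeable-trans (_ , _ , _ , A-min , Ai≡C₂ , A′-min) (_ , _ , _ , B-min , Bj≡C₃ , B′-min) =
    Transitivity.result A-min Ai≡C₂ A′-min B-min Bj≡C₃ B′-min

-- Relevance, assumed in the symmetric and transitive cases, follows from ∼pi.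
theorem1 : (G : Graph) →
    ((C : EdgeSet G) → Relevant G C → _∼pi_ G C C) ×
    ((C₁ C₂ : EdgeSet G) → Relevant G C₁ → Relevant G C₂ →
      _∼pi_ G C₁ C₂ → _∼pi_ G C₂ C₁) ×
    ((C₁ C₂ C₃ : EdgeSet G) → Relevant G C₁ → Relevant G C₂ → Relevant G C₃ →
      _∼pi_ G C₁ C₂ → _∼pi_ G C₂ C₃ → _∼pi_ G C₁ C₃)
theorem1 G =
  (λ C C-relevant → Interchangeable⇒∼pi (Interchangeable-refl C-relevant)) ,
  (λ C₁ C₂ _ _ C₁∼C₂ → Interchangeable⇒∼pi (Interchangeable-sym (∼pi⇒Interchangeable C₁∼C₂))) ,
  (λ C₁ C₂ C₃ _ _ _ C₁∼C₂ C₂∼C₃ →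
    Interchangeable⇒∼pi
      (Interchangeable-trans (∼pi⇒Interchangeable C₁∼C₂) (∼pi⇒Interchangeable C₂∼C₃)))
  where open CycleSpace G
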